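{- Let $q$ be a prime power and $n>1$. If two $q$-polynomials over $\mathbb{F}_{q^n}$ are equivalent, then their maximum fields of linearity coincide.
   Context: A $q$-polynomial over $\mathbb{F}_{q^n}$ is a polynomial $f(x)=\sum_{i=0}^{n-1}a_ix^{q^i}$ with coefficients in $\mathbb{F}_{q^n}$. The maximum field of linearity of $f$ is the largest subfield $\mathbb{F}_{q^m}$ ($m\mid n$) of $\mathbb{F}_{q^n}$ such that $f(\mu x)=\mu f(x)$ for all $\mu\in\mathbb{F}_{q^m}$, $x\in\mathbb{F}_{q^n}$. Two $q$-polynomials $f,h$ over $\mathbb{F}_{q^n}$ are equivalent if there is $\varphi\in\Gamma\mathrm{L}(2,q^n)$ (acting on $\mathbb{F}_{q^n}^2$, semilinearly) mapping the graph $\{(x,f(x)) : x\in\mathbb{F}_{q^n}\}$ onto the graph $\{(x,h(x)) : x\in\mathbb{F}_{q^n}\}$. -}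

module Defs where

open import Level using (Level; _⊔_) renaming (suc to lsuc)
open import Data.Nat as ℕ using (ℕ; zero; suc; _<_)
open import Data.Nat.Divisibility using (_∣_)
open import Data.Nat.Primality using (Prime)
open import Data.Fin using (Fin; toℕ) renaming (zero to fzero; suc to fsuc)
open import Data.Product using (Σ; ∃; _×_; _,_)
open import Relation.Nullary using (¬_)
open import Relation.Binary.PropositionalEquality as ≡ using (_≡_)
open import Algebra.Bundles using (CommutativeRing)
open import Algebra.Morphism.Structures using (module RingMorphisms)
open import Function.Bundles using (Bijection)

IsPrimePower : ℕ → Set
IsPrimePower q = Σ ℕ λ p → Σ ℕ λ k → Prime p × 0 < k × q ≡ p ℕ.^ k

record Field (c ℓ : Level) : Set (lsuc (c ⊔ ℓ)) where
  field
    commutativeRing : CommutativeRing c ℓ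
  open CommutativeRing commutativeRing public
  field
    0≉1     : ¬ (0# ≈ 1#)
    inverse : ∀ x → ¬ (x ≈ 0#) → Σ Carrier λ y → x * y ≈ 1#

module FieldTheory {c ℓ : Level} (K : Field c ℓ) where
  open Field K

  HasOrder : ℕ → Set (c ⊔ ℓ)
  HasOrder N = Bijection (≡.setoid (Fin N)) setoid

  pow : Carrier → ℕ → Carrier
  pow x zero    = 1#
  pow x (suc k) = x * pow x k

  sumFin : (n : ℕ) → (Fin n → Carrier) → Carrier
  sumFin zero    g = 0#
  sumFin (suc n) g = g fzero + sumFin n (λ i → g (fsuc i))

  IsAutomorphism : (Carrier → Carrier) → Set (c ⊔ ℓ)
  IsAutomorphism σ = RingMorphisms.IsRingIsomorphism rawRing rawRing σ

  qPoly : (q n : ℕ) → (Fin n → Carrier) → Carrier → Carrier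
  qPoly q n a x = sumFin n (λ i → a i * pow x (q ℕ.^ toℕ i))

  -- the subfield F_{q^m} of K = { μ | μ^{q^m} = μ }
  InSubfield : (q m : ℕ) → Carrier → Set ℓ
  InSubfield q m μ = pow μ (q ℕ.^ m) ≈ μ

  LinearOver : (q m : ℕ) → (Carrier → Carrier) → Set (c ⊔ ℓ)
  LinearOver q m f = ∀ μ → InSubfield q m μ → ∀ x → f (μ * x) ≈ μ * f x

  IsMaxFieldOfLinearity : (q n m : ℕ) → (Carrier → Carrier) → Set (c ⊔ ℓ)
  IsMaxFieldOfLinearity q n m f =
    m ∣ n × LinearOver q m f × (∀ m' → m' ∣ n → LinearOver q m' f → m' ∣ m)

  record ΓL2 : Set (c ⊔ ℓ) where
    field
      a b c' d : Carrier
      det≉0    : ¬ (a * d - b * c' ≈ 0#)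
      σ        : Carrier → Carrier
      σ-aut    : IsAutomorphism σ

    apply₁ : Carrier → Carrier → Carrier
    apply₁ x y = a * σ x + b * σ y

    apply₂ : Carrier → Carrier → Carrier
    apply₂ x y = c' * σ x + d * σ y

  MapsGraphOnto : ΓL2 → (Carrier → Carrier) → (Carrier → Carrier) → Set (c ⊔ ℓ)
  MapsGraphOnto φ f h =
    (∀ x → Σ Carrier λ y → (apply₁ x (f x) ≈ y) × (apply₂ x (f x) ≈ h y))
    × (∀ y → Σ Carrier λ x → (apply₁ x (f x) ≈ y) × (apply₂ x (f x) ≈ h y))
    where open ΓL2 φ

  Equivalent : (Carrier → Carrier) → (Carrier → Carrier) → Set (c ⊔ ℓ)
  Equivalent f h = Σ ΓL2 λ φ → MapsGraphOnto φ f h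

-- A semilinear map φ = (v ↦ A v^σ) ∈ ΓL(2, K) is a bijection of K², and it
-- commutes with scalars up to σ: φ(μ v) = σ(μ) φ(v). Since σ maps each
-- subfield F_{q^m} = { μ | μ^{q^m} = μ } onto itself, φ carries the graph of
-- an F_{q^m}-linear f onto the graph of an F_{q^m}-linear h and back, so f and
-- h are linear over exactly the same subfields and their maximal ones agree.
module Submission where

open import Defs
open import Data.Nat using (ℕ; zero; suc; _<_; _^_)
open import Data.Nat.Divisibility using (∣-antisym)
open import Data.Fin using (Fin; toℕ) renaming (zero to fzero; suc to fsuc)
open import Data.Product using (_,_; _×_; proj₁; proj₂)
open import Relation.Binary.PropositionalEquality using (_≡_)
open import Relation.Nullary using (¬_)
open import Algebra.Morphism.Structures using (module RingMorphisms)
import Algebra.Properties.Ring as RingProperties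
import Algebra.Solver.Ring.NaturalCoefficients.Default as NaturalSolver
import Relation.Binary.Reasoning.Setoid as SetoidReasoning

module _ {c ℓ} (K : Field c ℓ) where
  open Field K
  open FieldTheory K
  open RingProperties ring using ([y-z]x≈yx-zx)
  open SetoidReasoning setoid
  open NaturalSolver commutativeSemiring using (solve; _:=_; _:+_; _:*_)

  pow-cong : ∀ {x y} k → x ≈ y → pow x k ≈ pow y k
  pow-cong zero    _   = refl
  pow-cong (suc k) x≈y = *-cong x≈y (pow-cong k x≈y)

  sumFin-cong : ∀ n {g h : Fin n → Carrier} → (∀ i → g i ≈ h i) → sumFin n g ≈ sumFin n h
  sumFin-cong zero    _   = refl
  sumFin-cong (suc n) g≈h = +-cong (g≈h fzero) (sumFin-cong n (λ i → g≈h (fsuc i)))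

  qPoly-cong : ∀ q n a {x y} → x ≈ y → qPoly q n a x ≈ qPoly q n a y
  qPoly-cong q n a x≈y = sumFin-cong n (λ i → *-cong refl (pow-cong (q ^ toℕ i) x≈y))

  *-cancelˡ-≉0 : ∀ {x y z} → ¬ (x ≈ 0#) → x * y ≈ x * z → y ≈ z
  *-cancelˡ-≉0 {x} {y} {z} x≉0 xy≈xz with inverse x x≉0
  ... | x⁻¹ , xx⁻¹≈1 = begin
    y               ≈⟨ sym (*-identityˡ y) ⟩
    1# * y          ≈⟨ *-cong (trans (sym xx⁻¹≈1) (*-comm x x⁻¹)) refl ⟩
    (x⁻¹ * x) * y   ≈⟨ *-assoc x⁻¹ x y ⟩
    x⁻¹ * (x * y)   ≈⟨ *-cong refl xy≈xz ⟩
    x⁻¹ * (x * z)   ≈⟨ sym (*-assoc x⁻¹ x z) ⟩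
    (x⁻¹ * x) * z   ≈⟨ *-cong (trans (*-comm x⁻¹ x) xx⁻¹≈1) refl ⟩
    1# * z          ≈⟨ *-identityˡ z ⟩
    z               ∎

  u+v≈w+x⇒x-v≈u-w : ∀ {u v w x} → u + v ≈ w + x → x - v ≈ u - w
  u+v≈w+x⇒x-v≈u-w {u} {v} {w} {x} u+v≈w+x = begin
    x - v                       ≈⟨ sym (+-identityʳ (x - v)) ⟩
    (x - v) + 0#                ≈⟨ +-cong refl (sym (-‿inverseʳ w)) ⟩
    (x - v) + (w - w)           ≈⟨ regroup₁ x (- v) w (- w) ⟩
    (w + x) + (- v + - w)       ≈⟨ +-cong (sym u+v≈w+x) refl ⟩
    (u + v) + (- v + - w)       ≈⟨ sym (regroup₂ u v (- v) (- w)) ⟩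
    (u - w) + (v - v)           ≈⟨ +-cong refl (-‿inverseʳ v) ⟩
    (u - w) + 0#                ≈⟨ +-identityʳ (u - w) ⟩
    u - w                       ∎
    where
    regroup₁ : ∀ x nv w nw → (x + nv) + (w + nw) ≈ (w + x) + (nv + nw)
    regroup₁ = solve 4 (λ x nv w nw → (x :+ nv) :+ (w :+ nw) := (w :+ x) :+ (nv :+ nw)) refl
    regroup₂ : ∀ u v nv nw → (u + nw) + (v + nv) ≈ (u + v) + (nv + nw)
    regroup₂ = solve 4 (λ u v nv nw → (u :+ nw) :+ (v :+ nv) := (u :+ v) :+ (nv :+ nw)) refl

  -- Cramer's rule; the solver has only natural coefficients, so each identity is
  -- first proved in a subtraction-free form and then rearranged.
  cramerˡ : ∀ a b c d x y → (a * d - b * c) * x ≈ d * (a * x + b * y) - b * (c * x + d * y)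
  cramerˡ a b c d x y =
    trans ([y-z]x≈yx-zx x (a * d) (b * c)) (u+v≈w+x⇒x-v≈u-w (expand a b c d x y))
    where
    expand : ∀ a b c d x y → d * (a * x + b * y) + (b * c) * x ≈ b * (c * x + d * y) + (a * d) * x
    expand = solve 6 (λ a b c d x y →
      d :* (a :* x :+ b :* y) :+ (b :* c) :* x := b :* (c :* x :+ d :* y) :+ (a :* d) :* x) refl

  cramerʳ : ∀ a b c d x y → (a * d - b * c) * y ≈ a * (c * x + d * y) - c * (a * x + b * y)
  cramerʳ a b c d x y =
    trans ([y-z]x≈yx-zx y (a * d) (b * c)) (u+v≈w+x⇒x-v≈u-w (expand a b c d x y))
    where
    expand : ∀ a b c d x y → a * (c * x + d * y) + (b * c) * y ≈ c * (a * x + b * y) + (a * d) * y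
    expand = solve 6 (λ a b c d x y →
      a :* (c :* x :+ d :* y) :+ (b :* c) :* y := c :* (a :* x :+ b :* y) :+ (a :* d) :* y) refl

  linear-injective : ∀ {a b c d x y x' y'} → ¬ (a * d - b * c ≈ 0#) →
    a * x + b * y ≈ a * x' + b * y' → c * x + d * y ≈ c * x' + d * y' →
    x ≈ x' × y ≈ y'
  linear-injective {a} {b} {c} {d} {x} {y} {x'} {y'} det≉0 eq₁ eq₂ =
    *-cancelˡ-≉0 det≉0 (begin
      (a * d - b * c) * x                          ≈⟨ cramerˡ a b c d x y ⟩
      d * (a * x + b * y) - b * (c * x + d * y)    ≈⟨ difference-cong d b eq₁ eq₂ ⟩
      d * (a * x' + b * y') - b * (c * x' + d * y') ≈⟨ sym (cramerˡ a b c d x' y') ⟩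
      (a * d - b * c) * x'                         ∎) ,
    *-cancelˡ-≉0 det≉0 (begin
      (a * d - b * c) * y                          ≈⟨ cramerʳ a b c d x y ⟩
      a * (c * x + d * y) - c * (a * x + b * y)    ≈⟨ difference-cong a c eq₂ eq₁ ⟩
      a * (c * x' + d * y') - c * (a * x' + b * y') ≈⟨ sym (cramerʳ a b c d x' y') ⟩
      (a * d - b * c) * y'                         ∎)
    where
    difference-cong : ∀ r s {p p' t t'} → p ≈ p' → t ≈ t' → r * p - s * t ≈ r * p' - s * t'
    difference-cong r s p≈p' t≈t' = +-cong (*-cong refl p≈p') (-‿cong (*-cong refl t≈t'))

  module _ {σ : Carrier → Carrier} (σ-aut : IsAutomorphism σ) where
    open RingMorphisms.IsRingIsomorphism σ-aut

    σ-pow : ∀ x k → σ (pow x k) ≈ pow (σ x) k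
    σ-pow x zero    = 1#-homo
    σ-pow x (suc k) = trans (*-homo x (pow x k)) (*-cong refl (σ-pow x k))

    σ-preserves-InSubfield : ∀ q m {μ} → InSubfield q m μ → InSubfield q m (σ μ)
    σ-preserves-InSubfield q m {μ} μ∈ = trans (sym (σ-pow μ (q ^ m))) (⟦⟧-cong μ∈)

    σ-reflects-InSubfield : ∀ q m {μ} → InSubfield q m (σ μ) → InSubfield q m μ
    σ-reflects-InSubfield q m {μ} σμ∈ = injective (trans (σ-pow μ (q ^ m)) σμ∈)

    σ-combination-cong : ∀ u v {x x' y y'} → x ≈ x' → y ≈ y' →
      u * σ x + v * σ y ≈ u * σ x' + v * σ y'
    σ-combination-cong u v x≈x' y≈y' = +-cong (*-cong refl (⟦⟧-cong x≈x')) (*-cong refl (⟦⟧-cong y≈y'))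

    σ-combination-scale : ∀ u v k x y →
      u * σ (k * x) + v * σ (k * y) ≈ σ k * (u * σ x + v * σ y)
    σ-combination-scale u v k x y = trans
      (+-cong (*-cong refl (*-homo k x)) (*-cong refl (*-homo k y)))
      (solve 5 (λ u v k x y → u :* (k :* x) :+ v :* (k :* y) := k :* (u :* x :+ v :* y)) refl
        u v (σ k) (σ x) (σ y))

  module _ (φ : ΓL2) where
    open ΓL2 φ
    open RingMorphisms.IsRingIsomorphism σ-aut using (injective; surjective)

    apply-injective : ∀ {x y x' y'} → apply₁ x y ≈ apply₁ x' y' → apply₂ x y ≈ apply₂ x' y' →
      x ≈ x' × y ≈ y'
    apply-injective eq₁ eq₂ with linear-injective det≉0 eq₁ eq₂
    ... | σx≈σx' , σy≈σy' = injective σx≈σx' , injective σy≈σy'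

    apply₁-scale : ∀ k x y → apply₁ (k * x) (k * y) ≈ σ k * apply₁ x y
    apply₁-scale = σ-combination-scale σ-aut a b

    apply₂-scale : ∀ k x y → apply₂ (k * x) (k * y) ≈ σ k * apply₂ x y
    apply₂-scale = σ-combination-scale σ-aut c' d

    module _ {f h : Carrier → Carrier} (graph : MapsGraphOnto φ f h) (q m : ℕ) where

      MapsGraphOnto-preserves-LinearOver : (∀ {x y} → x ≈ y → h x ≈ h y) →
        LinearOver q m f → LinearOver q m h
      MapsGraphOnto-preserves-LinearOver h-cong f-lin μ μ∈ y with proj₂ graph y | surjective μ
      ... | x , x↦y , fx↦hy | μ' , σμ'≈μ with proj₁ graph (μ' * x)
      ... | z , μ'x↦z , fμ'x↦hz = begin
        h (μ * y)                    ≈⟨ h-cong (trans (sym μ'x↦μy) μ'x↦z) ⟩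
        h z                          ≈⟨ sym fμ'x↦hz ⟩
        apply₂ (μ' * x) (f (μ' * x)) ≈⟨ σ-combination-cong σ-aut c' d refl (f-lin μ' μ'∈ x) ⟩
        apply₂ (μ' * x) (μ' * f x)   ≈⟨ apply₂-scale μ' x (f x) ⟩
        σ μ' * apply₂ x (f x)        ≈⟨ *-cong (σμ'≈μ refl) fx↦hy ⟩
        μ * h y                      ∎
        where
        μ'∈ : InSubfield q m μ'
        μ'∈ = σ-reflects-InSubfield σ-aut q m (trans (pow-cong (q ^ m) (σμ'≈μ refl))
                                                (trans μ∈ (sym (σμ'≈μ refl))))
        μ'x↦μy : apply₁ (μ' * x) (f (μ' * x)) ≈ μ * y
        μ'x↦μy = trans (σ-combination-cong σ-aut a b refl (f-lin μ' μ'∈ x))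
                 (trans (apply₁-scale μ' x (f x)) (*-cong (σμ'≈μ refl) x↦y))

      MapsGraphOnto-reflects-LinearOver : (∀ {x y} → x ≈ y → f x ≈ f y) →
        LinearOver q m h → LinearOver q m f
      MapsGraphOnto-reflects-LinearOver f-cong h-lin μ μ∈ x with proj₁ graph x
      ... | y , x↦y , fx↦hy with proj₂ graph (σ μ * y)
      ... | x' , x'↦σμy , fx'↦hσμy =
        trans (f-cong μx≈x') (sym μfx≈fx')
        where
        μx↦σμy : apply₁ (μ * x) (μ * f x) ≈ apply₁ x' (f x')
        μx↦σμy = trans (apply₁-scale μ x (f x)) (trans (*-cong refl x↦y) (sym x'↦σμy))
        μfx↦hσμy : apply₂ (μ * x) (μ * f x) ≈ apply₂ x' (f x')
        μfx↦hσμy = trans (apply₂-scale μ x (f x))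
          (trans (*-cong refl fx↦hy)
          (trans (sym (h-lin (σ μ) (σ-preserves-InSubfield σ-aut q m μ∈) y)) (sym fx'↦hσμy)))
        μx≈x' : μ * x ≈ x'
        μx≈x' = proj₁ (apply-injective μx↦σμy μfx↦hσμy)
        μfx≈fx' : μ * f x ≈ f x'
        μfx≈fx' = proj₂ (apply-injective μx↦σμy μfx↦hσμy)

  IsMaxFieldOfLinearity-unique : ∀ {f h : Carrier → Carrier} q n {m₁ m₂} →
    (∀ m → LinearOver q m f → LinearOver q m h) → (∀ m → LinearOver q m h → LinearOver q m f) →
    IsMaxFieldOfLinearity q n m₁ f → IsMaxFieldOfLinearity q n m₂ h → m₁ ≡ m₂
  IsMaxFieldOfLinearity-unique q n {m₁} {m₂} f⇒h h⇒f (m₁∣n , f-lin , f-max) (m₂∣n , h-lin , h-max) =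
    ∣-antisym (h-max m₁ m₁∣n (f⇒h m₁ f-lin)) (f-max m₂ m₂∣n (h⇒f m₂ h-lin))

proposition2p3 : ∀ {c ℓ} (q n : ℕ) → IsPrimePower q → 1 < n →
    (K : Field c ℓ) → FieldTheory.HasOrder K (q ^ n) →
    (a b : Fin n → Field.Carrier K) →
    FieldTheory.Equivalent K (FieldTheory.qPoly K q n a) (FieldTheory.qPoly K q n b) →
    ∀ m₁ m₂ →
    FieldTheory.IsMaxFieldOfLinearity K q n m₁ (FieldTheory.qPoly K q n a) →
    FieldTheory.IsMaxFieldOfLinearity K q n m₂ (FieldTheory.qPoly K q n b) →
    m₁ ≡ m₂
proposition2p3 q n _ _ K _ a b (φ , graph) _ _ =
  IsMaxFieldOfLinearity-unique K q n
    (λ m → MapsGraphOnto-preserves-LinearOver K φ graph q m (qPoly-cong K q n b))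
    (λ m → MapsGraphOnto-reflects-LinearOver K φ graph q m (qPoly-cong K q n a))
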